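{- Every $10\times 5$ binary $3$-covering array is equivalent to $$\begin{pmatrix}1&0&0&0&0\\1&0&1&1&1\\1&1&0&1&1\\1&1&1&0&1\\1&1&1&1&0\\0&1&0&0&0\\0&0&1&0&0\\0&0&0&1&0\\0&0&0&0&1\\0&1&1&1&1\end{pmatrix}.$$
   Context: A binary $t$-covering array of size $m$ and degree $n$ is an $m\times n$ matrix with entries in $\{0,1\}$ such that for any $t$ distinct columns, all $2^t$ binary vectors of length $t$ occur at least once as the restriction of some row to those columns. Two binary matrices are equivalent if one can be transformed into the other by a sequence of row permutations, column permutations, and complementations of individual columns (swapping $0$ and $1$ in that column). -}

module Defs where

open import Data.Nat using (ℕ)
open import Data.Bool using (Bool; true; false; not)
open import Data.Fin using (Fin)
open import Data.Fin.Properties using (_≟_)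
open import Data.Product using (∃; _,_)
open import Relation.Binary.PropositionalEquality using (_≡_; _≢_)
open import Relation.Nullary using (yes; no)
open import Function.Bundles using (_↔_; Inverse)

BinMatrix : ℕ → ℕ → Set
BinMatrix m n = Fin m → Fin n → Bool

IsCoveringArray : (t m n : ℕ) → BinMatrix m n → Set
IsCoveringArray t m n A =
  (c : Fin t → Fin n) → (∀ i j → c i ≡ c j → i ≡ j) →
  (v : Fin t → Bool) →
  ∃ λ (r : Fin m) → ∀ i → A r (c i) ≡ v i

complementCol : ∀ {m n} → Fin n → BinMatrix m n → BinMatrix m n
complementCol j A r k with k ≟ j
... | yes _ = not (A r k)
... | no _  = A r k

data Step {m n : ℕ} : BinMatrix m n → BinMatrix m n → Set where
  rowPerm : (σ : Fin m ↔ Fin m) (A : BinMatrix m n) →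
            Step A (λ r k → A (Inverse.to σ r) k)
  colPerm : (τ : Fin n ↔ Fin n) (A : BinMatrix m n) →
            Step A (λ r k → A r (Inverse.to τ k))
  compl   : (j : Fin n) (A : BinMatrix m n) →
            Step A (complementCol j A)

data Equivalent {m n : ℕ} : BinMatrix m n → BinMatrix m n → Set where
  done : ∀ {A B} → (∀ r k → A r k ≡ B r k) → Equivalent A B
  step : ∀ {A B C} → Step A B → Equivalent B C → Equivalent A C

open import Data.Vec using (Vec; lookup; []; _∷_)

fromRows : ∀ {m n} → Vec (Vec Bool n) m → BinMatrix m n
fromRows rows r k = lookup (lookup rows r) k

private
  O I : Bool
  O = false
  I = true

M₀ : BinMatrix 10 5
M₀ = fromRows
  ( (I ∷ O ∷ O ∷ O ∷ O ∷ [])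
  ∷ (I ∷ O ∷ I ∷ I ∷ I ∷ [])
  ∷ (I ∷ I ∷ O ∷ I ∷ I ∷ [])
  ∷ (I ∷ I ∷ I ∷ O ∷ I ∷ [])
  ∷ (I ∷ I ∷ I ∷ I ∷ O ∷ [])
  ∷ (O ∷ I ∷ O ∷ O ∷ O ∷ [])
  ∷ (O ∷ O ∷ I ∷ O ∷ O ∷ [])
  ∷ (O ∷ O ∷ O ∷ I ∷ O ∷ [])
  ∷ (O ∷ O ∷ O ∷ O ∷ I ∷ [])
  ∷ (O ∷ I ∷ I ∷ I ∷ I ∷ [])
  ∷ [])

module Submission where

-- Complementing every column in which the first row has a 1
-- turns A into a covering array B whose first row is zero; it therefore
-- suffices to classify such normalised arrays.  Every 3-covering array B
-- determines the set S of its rows other than the first: S consists of at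
-- most 9 nonzero vectors of {0,1}^5 which, restricted to any three
-- columns, realise all 7 nonzero patterns of {0,1}^3.  A verified
-- branch-and-bound search ('HittingSearch') lists a family of candidate
-- sets which provably contains every set of this kind; evaluating the
-- search shows that each listed set contains the rows of M₀ (with its
-- first column complemented) after a suitable transposition of columns.
-- Ten distinct target rows found among the ten rows of B determine a row
-- permutation, and undoing the column transposition and complementation
-- yields M₀.

open import Defs
open import Data.Nat using (ℕ; zero; suc; _≤_; _≤?_; z≤n; s≤s; s≤s⁻¹)
open import Data.Nat.Properties using (≤-refl; ≤-trans; ≤-reflexive; n<1+n)
open import Data.Bool using (Bool; true; false; not; _xor_; if_then_else_)
open import Data.Bool.Properties
  using (xor-identityʳ; xor-same; not-distribʳ-xor; not-involutive; ¬-not)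
  renaming (_≟_ to _≟ᵇ_)
open import Data.Fin using (Fin; zero; suc; #_)
open import Data.Fin.Properties using (_≟_; any?; all?; pigeonhole)
import Data.Fin as Fin
import Data.Fin.Properties as Fin
open import Data.Fin.Permutation using (permutation; transpose; inverseˡ)
open import Data.Vec using (Vec; []; _∷_; lookup)
import Data.Vec as Vec
open import Data.Vec.Properties
  using (≡-dec; lookup∘tabulate; tabulate∘lookup; tabulate-cong; ∷-injectiveʳ)
open import Data.List using (List; []; _∷_; map; _++_; length; filter; allFin)
import Data.List as List
open import Data.List.Properties using (filter-all; length-removeAt′; length-tabulate)
open import Data.List.Relation.Unary.All using (All; []; _∷_)
import Data.List.Relation.Unary.All as All
open import Data.List.Relation.Unary.All.Properties using (all-filter)
import Data.List.Relation.Unary.All.Properties as All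
open import Data.List.Relation.Unary.Any using (Any; here; there; _─_)
import Data.List.Relation.Unary.Any as Any
open import Data.List.Relation.Unary.AllPairs using ([]; _∷_)
open import Data.List.Relation.Unary.Unique.Propositional using (Unique)
import Data.List.Relation.Unary.Unique.Propositional.Properties as Unique
open import Data.List.Membership.Propositional using (_∈_; lose)
open import Data.List.Membership.Propositional.Properties
  using (∈-map⁺; ∈-map⁻; ∈-++⁺ˡ; ∈-++⁺ʳ; ∈-filter⁺; ∈-filter⁻; ∈-allFin;
         ∈-tabulate⁺; ∈-tabulate⁻)
import Data.List.Membership.DecPropositional as DecMembership
open import Data.Product using (_×_; _,_; proj₁; proj₂; ∃; ∃₂)
open import Data.Empty using (⊥-elim)
open import Function using (_∘_)
open import Function.Bundles using (_↔_; Inverse)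
open import Level using (0ℓ)
open import Relation.Binary.Definitions using (DecidableEquality)
open import Relation.Binary.PropositionalEquality using (_≡_; _≢_; refl; sym; trans; cong)
open import Relation.Nullary using (¬_; Dec; yes; no; does; ¬?; _×-dec_; _→-dec_)
open import Relation.Nullary.Decidable using (dec-true; from-yes)
open import Relation.Unary using (Pred; Decidable)

_≋_ : ∀ {m n} → BinMatrix m n → BinMatrix m n → Set
A ≋ B = ∀ r k → A r k ≡ B r k

-- The row of a matrix as a vector, so that rows can be compared decidably.
rowOf : ∀ {m n} → BinMatrix m n → Fin m → Vec Bool n
rowOf A r = Vec.tabulate (A r)

rowOf-entries : ∀ {m m′ n} (A : BinMatrix m n) (B : BinMatrix m′ n) {r r′} →
                rowOf A r ≡ rowOf B r′ → ∀ k → A r k ≡ B r′ k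
rowOf-entries A B {r} {r′} eq k =
  trans (sym (lookup∘tabulate (A r) k))
        (trans (cong (λ v → lookup v k) eq) (lookup∘tabulate (B r′) k))

module _ {m n : ℕ} where

  complementCol-cong : ∀ j {A B : BinMatrix m n} → A ≋ B → complementCol j A ≋ complementCol j B
  complementCol-cong j A≋B r k with k ≟ j
  ... | yes _ = cong not (A≋B r k)
  ... | no _  = A≋B r k

  complementCol-hit : ∀ j (A : BinMatrix m n) r → complementCol j A r j ≡ not (A r j)
  complementCol-hit j A r with j ≟ j
  ... | yes _  = refl
  ... | no j≢j = ⊥-elim (j≢j refl)

  complementCol-miss : ∀ {j k} (A : BinMatrix m n) r → k ≢ j → complementCol j A r k ≡ A r k
  complementCol-miss {j} {k} A r k≢j with k ≟ j
  ... | yes k≡j = ⊥-elim (k≢j k≡j)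
  ... | no _    = refl

  complementCol-involutive : ∀ j (A : BinMatrix m n) → complementCol j (complementCol j A) ≋ A
  complementCol-involutive j A r k = byColumn (k ≟ j)
    where
    byColumn : Dec (k ≡ j) → complementCol j (complementCol j A) r k ≡ A r k
    byColumn (yes refl) = trans (complementCol-hit j _ r)
                            (trans (cong not (complementCol-hit j A r)) (not-involutive (A r j)))
    byColumn (no k≢j)   = trans (complementCol-miss _ r k≢j) (complementCol-miss A r k≢j)

  Equivalent-respˡ : ∀ {A A′ C : BinMatrix m n} → A ≋ A′ → Equivalent A′ C → Equivalent A C
  Equivalent-respˡ e (done p) = done (λ r k → trans (e r k) (p r k))
  Equivalent-respˡ e (step (rowPerm σ _) q) =
    step (rowPerm σ _) (Equivalent-respˡ (λ r → e (Inverse.to σ r)) q)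
  Equivalent-respˡ e (step (colPerm τ _) q) =
    step (colPerm τ _) (Equivalent-respˡ (λ r k → e r (Inverse.to τ k)) q)
  Equivalent-respˡ e (step (compl j _) q) =
    step (compl j _) (Equivalent-respˡ (complementCol-cong j e) q)

  Equivalent-trans : ∀ {A B C : BinMatrix m n} → Equivalent A B → Equivalent B C → Equivalent A C
  Equivalent-trans (done e) q = Equivalent-respˡ e q
  Equivalent-trans (step s p) q = step s (Equivalent-trans p q)

  complement-equivalent : ∀ j (C : BinMatrix m n) → Equivalent (complementCol j C) C
  complement-equivalent j C = step (compl j _) (done (complementCol-involutive j C))

  unpermuteColumns : (Fin n ↔ Fin n) → BinMatrix m n → BinMatrix m n
  unpermuteColumns τ C r k = C r (Inverse.from τ k)

  unpermute-equivalent : ∀ τ (C : BinMatrix m n) → Equivalent (unpermuteColumns τ C) C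
  unpermute-equivalent τ C = step (colPerm τ _) (done (λ r k → cong (C r) (inverseˡ τ)))

flipBy : ∀ {m n} → (Fin n → Bool) → BinMatrix m n → BinMatrix m n
flipBy s A r k = A r k xor s k

_↾_ : ∀ {n} → (Fin n → Bool) → List (Fin n) → Fin n → Bool
(s ↾ []) k = false
(s ↾ (j ∷ js)) k with k ≟ j
... | yes _ = s k
... | no _  = (s ↾ js) k

↾-∈ : ∀ {n} (s : Fin n → Bool) {js k} → k ∈ js → (s ↾ js) k ≡ s k
↾-∈ s {j ∷ js} {k} k∈ with k ≟ j | k∈
... | yes _  | _          = refl
... | no k≢j | here k≡j   = ⊥-elim (k≢j k≡j)
... | no _   | there k∈js = ↾-∈ s k∈js

module _ {m n : ℕ} {A C : BinMatrix m n} where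

  flipBy-cong : ∀ {s s′ : Fin n → Bool} → (∀ k → s k ≡ s′ k) → flipBy s A ≋ flipBy s′ A
  flipBy-cong s≗s′ r k = cong (A r k xor_) (s≗s′ k)

  -- Two patterns that agree outside column j differ by at most one
  -- complementation of column j.
  flip-adjust : ∀ {s s′ : Fin n → Bool} j → (∀ k → k ≢ j → s k ≡ s′ k) →
                Equivalent (flipBy s′ A) C → Equivalent (flipBy s A) C
  flip-adjust {s} {s′} j agree q with s j ≟ᵇ s′ j
  ... | yes same = Equivalent-respˡ (flipBy-cong agreeEverywhere) q
    where
    agreeEverywhere : ∀ k → s k ≡ s′ k
    agreeEverywhere k with k ≟ j
    ... | yes refl = same
    ... | no k≢j   = agree k k≢j
  ... | no differ = step (compl j _) (Equivalent-respˡ complemented q)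
    where
    complemented : complementCol j (flipBy s A) ≋ flipBy s′ A
    complemented r k with k ≟ j
    ... | yes refl = trans (not-distribʳ-xor (A r j) (s j))
                           (cong (A r j xor_) (sym (¬-not (differ ∘ sym))))
    ... | no k≢j   = cong (A r k xor_) (agree k k≢j)

  -- Enlarging the restriction by one column changes the pattern only in
  -- that column, so induction on js leads down to the zero pattern.
  flip-restricted : ∀ s js → Equivalent (flipBy (s ↾ js) A) C → Equivalent A C
  flip-restricted s [] q = Equivalent-respˡ (λ r k → sym (xor-identityʳ (A r k))) q
  flip-restricted s (j ∷ js) q = flip-restricted s js (flip-adjust j unchanged q)
    where
    unchanged : ∀ k → k ≢ j → (s ↾ js) k ≡ (s ↾ (j ∷ js)) k
    unchanged k k≢j with k ≟ j
    ... | yes k≡j = ⊥-elim (k≢j k≡j)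
    ... | no _    = refl

  flip-equivalent : ∀ s → Equivalent (flipBy s A) C → Equivalent A C
  flip-equivalent s q =
    flip-restricted s (allFin n) (Equivalent-respˡ (flipBy-cong (λ k → ↾-∈ s (∈-allFin k))) q)

xor-cancelʳ : ∀ a b → (a xor b) xor b ≡ a
xor-cancelʳ false false = refl
xor-cancelʳ false true  = refl
xor-cancelʳ true  false = refl
xor-cancelʳ true  true  = refl

-- Flipping columns maps covering arrays to covering arrays: a pattern v is
-- found in the flipped array where v xor s was found in the original.
flip-covering : ∀ {t m n} (s : Fin n → Bool) (A : BinMatrix m n) →
                IsCoveringArray t m n A → IsCoveringArray t m n (flipBy s A)
flip-covering s A cov c c-inj v with cov c c-inj (λ i → v i xor s (c i))
... | r , hit = r , λ i → trans (cong (_xor s (c i)) (hit i)) (xor-cancelʳ (v i) (s (c i)))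

flip-first-row : ∀ {m n} (A : BinMatrix (suc m) n) k → flipBy (A zero) A zero k ≡ false
flip-first-row A k = xor-same (A zero k)

-- An injective map Fin n → Fin n is onto: otherwise it would map the
-- n + 1 elements  missing value ∷ image  into n values without collision.
injective⇒surjective : ∀ {n} (g : Fin n → Fin n) → (∀ {i j} → g i ≡ g j → i ≡ j) →
                       ∀ r → ∃ λ i → g i ≡ r
injective⇒surjective {n} g g-inj r with any? (λ i → g i ≟ r)
... | yes found = found
... | no missed  = ⊥-elim (collision-free (pigeonhole (n<1+n n) extended))
  where
  extended : Fin (suc n) → Fin n
  extended zero    = r
  extended (suc i) = g i
  collision-free : ¬ (∃₂ λ i j → i Fin.< j × extended i ≡ extended j)
  collision-free (zero  , suc j , _   , r≡gj)  = missed (j , sym r≡gj)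
  collision-free (suc i , suc j , i<j , gi≡gj) = Fin.<-irrefl (cong suc (g-inj gi≡gj)) i<j

rows-equivalent : ∀ {m n} (T B : BinMatrix m n) →
                  (∀ i i′ → (∀ k → T i k ≡ T i′ k) → i ≡ i′) →
                  (∀ i → ∃ λ r → ∀ k → B r k ≡ T i k) →
                  Equivalent B T
rows-equivalent {m} T B distinct located = step (rowPerm σ B) (done (λ i → proj₂ (located i)))
  where
  g : Fin m → Fin m
  g i = proj₁ (located i)
  g-inj : ∀ {i i′} → g i ≡ g i′ → i ≡ i′
  g-inj {i} {i′} gi≡gi′ = distinct i i′ λ k →
    trans (sym (proj₂ (located i) k)) (trans (cong (λ r → B r k) gi≡gi′) (proj₂ (located i′) k))
  onto : ∀ r → ∃ λ i → g i ≡ r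
  onto = injective⇒surjective g g-inj
  σ : Fin m ↔ Fin m
  σ = permutation g (λ r → proj₁ (onto r))
                    (λ r → proj₂ (onto r)) (λ i → g-inj (proj₂ (onto (g i))))

∈-─ : ∀ {A : Set} {x z : A} {ys} (x∈ys : x ∈ ys) → z ∈ ys → z ≢ x → z ∈ (ys ─ x∈ys)
∈-─ (here refl) (here refl) z≢x = ⊥-elim (z≢x refl)
∈-─ (here _)    (there z∈)  _   = z∈
∈-─ (there _)   (here refl) _   = here refl
∈-─ (there x∈)  (there z∈)  z≢x = there (∈-─ x∈ z∈ z≢x)

unique-length : ∀ {A : Set} {xs ys : List A} → Unique xs → All (_∈ ys) xs → length xs ≤ length ys
unique-length [] [] = z≤n
unique-length {xs = x ∷ _} {ys} (x≢xs ∷ xs-unique) (x∈ys ∷ xs⊆ys) =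
  ≤-trans (s≤s (unique-length xs-unique (All.zipWith inRest (xs⊆ys , x≢xs))))
          (≤-reflexive (sym (length-removeAt′ ys _)))
  where
  inRest : ∀ {z} → z ∈ ys × x ≢ z → z ∈ (ys ─ x∈ys)
  inRest (z∈ys , x≢z) = ∈-─ x∈ys z∈ys (x≢z ∘ sym)

-- A requirement labels every
-- candidate x by a pattern and lists the patterns that must be carried by
-- some selected candidate.  'search cs Gs k' lists selections of at most k
-- candidates from cs; it is complete: every selection that meets all
-- requirements appears in the list.  Branches are cut as soon as some
-- requirement wants more patterns than the remaining budget allows, or
-- wants a pattern that no remaining candidate carries.
module HittingSearch {X Y : Set} (_≟_ : DecidableEquality Y) where

  record Requirement : Set where
    constructor requirement
    field
      label  : X → Y
      wanted : List Y
  open Requirement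

  -- Selecting x satisfies the wanted pattern carried by x.
  discharge : X → Requirement → Requirement
  discharge x G = requirement (label G) (filter (λ w → ¬? (label G x ≟ w)) (wanted G))

  Feasible : List X → ℕ → Requirement → Set
  Feasible cs k G = length (wanted G) ≤ k × All (λ w → Any (λ x → label G x ≡ w) cs) (wanted G)

  feasible? : ∀ cs k → Decidable (Feasible cs k)
  feasible? cs k G = (length (wanted G) ≤? k)
              ×-dec All.all? (λ w → Any.any? (λ x → label G x ≟ w) cs) (wanted G)

  search : List X → List Requirement → ℕ → List (List X)
  branch : List X → List Requirement → ℕ → List (List X)
  extend : X → List X → List Requirement → ℕ → List (List X)
  search cs Gs k = if does (All.all? (feasible? cs k) Gs) then branch cs Gs k else []
  branch []       Gs k = [] ∷ []
  branch (x ∷ cs) Gs k = search cs Gs k ++ extend x cs Gs k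
  extend x cs Gs zero    = []
  extend x cs Gs (suc k) = map (x ∷_) (search cs (map (discharge x) Gs) k)

  module Completeness {P : Pred X 0ℓ} (P? : Decidable P) where

    Realised : List X → Requirement → Set
    Realised cs G = All (λ w → Any (λ x → P x × label G x ≡ w) cs) (wanted G)

    realised-skip : ∀ {x cs G} → ¬ P x → Realised (x ∷ cs) G → Realised cs G
    realised-skip ¬Px = All.map λ where
      (here (Px , _)) → ⊥-elim (¬Px Px)
      (there found)   → found

    realised-take : ∀ {x cs G} → Realised (x ∷ cs) G → Realised cs (discharge x G)
    realised-take {x} {cs} {G} realised = All.tabulate λ w∈ →
      let (w∈wanted , x≢w) = ∈-filter⁻ (λ w → ¬? (label G x ≟ w)) w∈ in
      byCarrier x≢w (All.lookup realised w∈wanted)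
      where
      byCarrier : ∀ {w} → label G x ≢ w → Any (λ y → P y × label G y ≡ w) (x ∷ cs) →
                  Any (λ y → P y × label G y ≡ w) cs
      byCarrier x≢w (here (_ , x≡w)) = ⊥-elim (x≢w x≡w)
      byCarrier _   (there found)    = found

    discharge-length : ∀ x G → Unique (wanted G) →
                       length (wanted G) ≤ suc (length (wanted (discharge x G)))
    discharge-length x (requirement ℓ []) _ = z≤n
    discharge-length x (requirement ℓ (w ∷ ws)) (w∉ws ∷ ws-unique) with ℓ x ≟ w
    ... | yes refl rewrite filter-all (λ v → ¬? (ℓ x ≟ v)) w∉ws = ≤-refl
    ... | no _ = s≤s (discharge-length x (requirement ℓ ws) ws-unique)

    -- Distinct wanted patterns need distinct selected candidates.
    realised-budget : ∀ cs G → Unique (wanted G) → Realised cs G →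
                      length (wanted G) ≤ length (filter P? cs)
    realised-budget [] (requirement ℓ []) _ [] = z≤n
    realised-budget [] (requirement ℓ (w ∷ ws)) _ (() ∷ _)
    realised-budget (x ∷ cs) G unique realised with P? x
    ... | yes Px =
      ≤-trans (discharge-length x G unique)
              (s≤s (realised-budget cs (discharge x G) (Unique.filter⁺ _ unique)
                                    (realised-take realised)))
    ... | no ¬Px =
      realised-budget cs G unique (realised-skip ¬Px realised)

    realised-feasible : ∀ {cs k} G → Unique (wanted G) → Realised cs G →
                        length (filter P? cs) ≤ k → Feasible cs k G
    realised-feasible {cs} G unique realised bound =
      ≤-trans (realised-budget cs G unique realised) bound ,
      All.map (Any.map proj₂) realised

    accepted : ∀ {b} {x : List X} {ys} → b ≡ true → x ∈ ys → x ∈ (if b then ys else [])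
    accepted refl x∈ys = x∈ys

    search-complete : ∀ cs Gs k → All (Unique ∘ wanted) Gs → All (Realised cs) Gs →
                      length (filter P? cs) ≤ k → filter P? cs ∈ search cs Gs k
    branch-complete : ∀ cs Gs k → All (Unique ∘ wanted) Gs → All (Realised cs) Gs →
                      length (filter P? cs) ≤ k → filter P? cs ∈ branch cs Gs k
    search-complete cs Gs k uniques realised bound =
      accepted (dec-true (All.all? (feasible? cs k) Gs)
                         (All.zipWith (λ (u , r) → realised-feasible _ u r bound) (uniques , realised)))
               (branch-complete cs Gs k uniques realised bound)
    branch-complete [] Gs k _ _ _ = here refl
    branch-complete (x ∷ cs) Gs k uniques realised bound with P? x
    ... | no ¬Px =
      ∈-++⁺ˡ (search-complete cs Gs k uniques (All.map (realised-skip ¬Px) realised) bound)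
    branch-complete (x ∷ cs) Gs (suc k) uniques realised bound | yes Px =
      ∈-++⁺ʳ _ (∈-map⁺ (x ∷_) (search-complete cs (map (discharge x) Gs) k
        (All.map⁺ (All.map (Unique.filter⁺ _) uniques))
        (All.map⁺ (All.map realised-take realised))
        (s≤s⁻¹ bound)))
    branch-complete (x ∷ cs) Gs zero uniques realised () | yes Px

allVecs : (n : ℕ) → List (Vec Bool n)
allVecs zero    = [] ∷ []
allVecs (suc n) = map (false ∷_) (allVecs n) ++ map (true ∷_) (allVecs n)

allVecs-complete : ∀ {n} (v : Vec Bool n) → v ∈ allVecs n
allVecs-complete []          = here refl
allVecs-complete (false ∷ v) = ∈-++⁺ˡ (∈-map⁺ (false ∷_) (allVecs-complete v))
allVecs-complete (true ∷ v)  = ∈-++⁺ʳ _ (∈-map⁺ (true ∷_) (allVecs-complete v))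

allVecs-unique : ∀ n → Unique (allVecs n)
allVecs-unique zero    = [] ∷ []
allVecs-unique (suc n) =
  Unique.++⁺ (Unique.map⁺ ∷-injectiveʳ (allVecs-unique n))
             (Unique.map⁺ ∷-injectiveʳ (allVecs-unique n)) heads-differ
  where
  heads-differ : ∀ {v} → ¬ (v ∈ map (false ∷_) (allVecs n) × v ∈ map (true ∷_) (allVecs n))
  heads-differ (v∈₀ , v∈₁) with ∈-map⁻ (false ∷_) v∈₀ | ∈-map⁻ (true ∷_) v∈₁
  ... | _ , _ , refl | _ , _ , ()

_≟ᵛ_ : ∀ {n} → DecidableEquality (Vec Bool n)
_≟ᵛ_ = ≡-dec _≟ᵇ_

NonZero : ∀ {n} → Vec Bool n → Set
NonZero v = ∃ λ k → lookup v k ≡ true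

nonZero? : ∀ {n} → Decidable (NonZero {n})
nonZero? v = any? (λ k → lookup v k ≟ᵇ true)

nonzeroVecs : (n : ℕ) → List (Vec Bool n)
nonzeroVecs n = filter nonZero? (allVecs n)

nonzeroVecs-unique : ∀ n → Unique (nonzeroVecs n)
nonzeroVecs-unique n = Unique.filter⁺ nonZero? (allVecs-unique n)

triples : List (Vec (Fin 5) 3)
triples = (# 0 ∷ # 1 ∷ # 2 ∷ []) ∷ (# 0 ∷ # 1 ∷ # 3 ∷ []) ∷ (# 0 ∷ # 1 ∷ # 4 ∷ [])
        ∷ (# 0 ∷ # 2 ∷ # 3 ∷ []) ∷ (# 0 ∷ # 2 ∷ # 4 ∷ []) ∷ (# 0 ∷ # 3 ∷ # 4 ∷ [])
        ∷ (# 1 ∷ # 2 ∷ # 3 ∷ []) ∷ (# 1 ∷ # 2 ∷ # 4 ∷ []) ∷ (# 1 ∷ # 3 ∷ # 4 ∷ [])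
        ∷ (# 2 ∷ # 3 ∷ # 4 ∷ []) ∷ []

DistinctColumns : Vec (Fin 5) 3 → Set
DistinctColumns t = ∀ i i′ → lookup t i ≡ lookup t i′ → i ≡ i′

triples-distinct : All DistinctColumns triples
triples-distinct = from-yes (All.all? (λ t → all? λ i → all? λ i′ →
                                (lookup t i ≟ lookup t i′) →-dec (i ≟ i′)) triples)

open HittingSearch {Vec Bool 5} {Vec Bool 3} _≟ᵛ_
open DecMembership (_≟ᵛ_ {5}) using (_∈?_)

restrictTo : Vec (Fin 5) 3 → Vec Bool 5 → Vec Bool 3
restrictTo t x = Vec.tabulate (λ i → lookup x (lookup t i))

-- Covering the columns t by rows other than a zero first row means
-- realising each nonzero pattern on t.
columnRequirement : Vec (Fin 5) 3 → Requirement
columnRequirement t = requirement (restrictTo t) (nonzeroVecs 3)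

requirements : List Requirement
requirements = map columnRequirement triples

requirements-unique : All (Unique ∘ Requirement.wanted) requirements
requirements-unique =
  All.map⁺ {xs = triples} {f = columnRequirement} (All.tabulate (λ _ → nonzeroVecs-unique 3))

-- M₀ with its first column complemented has a zero first row; 'target j'
-- additionally has columns 0 and j exchanged.
M₀′ : BinMatrix 10 5
M₀′ = complementCol (# 0) M₀

target : Fin 5 → BinMatrix 10 5
target j = unpermuteColumns (transpose (# 0) j) M₀′

target-equivalent : ∀ j → Equivalent (target j) M₀
target-equivalent j =
  Equivalent-trans (unpermute-equivalent (transpose (# 0) j) M₀′) (complement-equivalent (# 0) M₀)

M₀′-first-row : ∀ k → M₀′ zero k ≡ false
M₀′-first-row zero                         = refl
M₀′-first-row (suc zero)                   = refl
M₀′-first-row (suc (suc zero))             = refl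
M₀′-first-row (suc (suc (suc zero)))       = refl
M₀′-first-row (suc (suc (suc (suc zero)))) = refl

target-distinct : ∀ j i i′ → rowOf (target j) i ≡ rowOf (target j) i′ → i ≡ i′
target-distinct = from-yes (all? λ j → all? λ i → all? λ i′ →
                    (rowOf (target j) i ≟ᵛ rowOf (target j) i′) →-dec (i ≟ i′))

Explained : List (Vec Bool 5) → Set
Explained sel = ∃ λ j → ∀ i → rowOf (target j) (suc i) ∈ sel

-- The computational heart of the proof, checked by evaluation: every
-- selection listed by the search is explained.  The certificate is opaque
-- so that using it never triggers a re-evaluation of the search.
opaque
  every-selection-explained : All Explained (search (nonzeroVecs 5) requirements 9)
  every-selection-explained =
    from-yes (All.all? (λ sel → any? λ j → all? λ i → rowOf (target j) (suc i) ∈? sel)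
                       (search (nonzeroVecs 5) requirements 9))

module Normalised (B : BinMatrix 10 5) (cov : IsCoveringArray 3 10 5 B)
                  (zeroRow : ∀ k → B zero k ≡ false) where

  laterRows : List (Vec Bool 5)
  laterRows = List.tabulate (λ r → rowOf B (suc r))

  open Completeness (_∈? laterRows)

  selection : List (Vec Bool 5)
  selection = filter (_∈? laterRows) (nonzeroVecs 5)

  selection-size : length selection ≤ 9
  selection-size = ≤-trans
    (unique-length (Unique.filter⁺ (_∈? laterRows) (nonzeroVecs-unique 5))
                   (all-filter (_∈? laterRows) (nonzeroVecs 5)))
    (≤-reflexive (length-tabulate (λ r → rowOf B (suc r))))

  -- Each nonzero pattern w on the columns t is found in some row; that row
  -- is not the zero first row, so it is a selected nonzero vector.
  covering-realised : ∀ t → DistinctColumns t → Realised (nonzeroVecs 5) (columnRequirement t)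
  covering-realised t distinct = All.tabulate λ {w} w∈ →
    found w (proj₂ (∈-filter⁻ nonZero? {xs = allVecs 3} w∈)) (cov (lookup t) distinct (lookup w))
    where
    found : ∀ w → NonZero w → (∃ λ r → ∀ i → B r (lookup t i) ≡ lookup w i) →
            Any (λ x → x ∈ laterRows × restrictTo t x ≡ w) (nonzeroVecs 5)
    found w (i , wᵢ) (zero , hit) with () ← trans (sym (zeroRow (lookup t i))) (trans (hit i) wᵢ)
    found w (i , wᵢ) (suc r , hit) =
      lose x∈nonzero (∈-tabulate⁺ {f = λ r → rowOf B (suc r)} r , restricted)
      where
      entry : ∀ i → lookup (rowOf B (suc r)) (lookup t i) ≡ lookup w i
      entry i = trans (lookup∘tabulate (B (suc r)) (lookup t i)) (hit i)
      x∈nonzero : rowOf B (suc r) ∈ nonzeroVecs 5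
      x∈nonzero = ∈-filter⁺ nonZero? (allVecs-complete (rowOf B (suc r)))
                                     (lookup t i , trans (entry i) wᵢ)
      restricted : restrictTo t (rowOf B (suc r)) ≡ w
      restricted = trans (tabulate-cong entry) (tabulate∘lookup w)

  requirements-realised : All (Realised (nonzeroVecs 5)) requirements
  requirements-realised = All.map⁺ {xs = triples} {f = columnRequirement}
    (All.tabulate (λ {t} t∈ → covering-realised t (All.lookup triples-distinct t∈)))

  selection-listed : selection ∈ search (nonzeroVecs 5) requirements 9
  selection-listed = search-complete (nonzeroVecs 5) requirements 9
    requirements-unique requirements-realised selection-size

  located : ∀ j → (∀ i → rowOf (target j) (suc i) ∈ selection) →
            ∀ i → ∃ λ r → ∀ k → B r k ≡ target j i k
  located j _ zero =
    zero , λ k → trans (zeroRow k) (sym (M₀′-first-row (Inverse.from (transpose (# 0) j) k)))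
  located j in-selection (suc i)
    with ∈-tabulate⁻ (proj₂ (∈-filter⁻ (_∈? laterRows) {xs = nonzeroVecs 5} (in-selection i)))
  ... | r , same = suc r , λ k → sym (rowOf-entries (target j) B same k)

  explained : Explained selection
  explained = All.lookup every-selection-explained selection-listed

  equivalent : Equivalent B M₀
  equivalent =
    Equivalent-trans
      (rows-equivalent (target j) B
        (λ i i′ same → target-distinct j i i′ (tabulate-cong same))
        (located j (proj₂ explained)))
      (target-equivalent j)
    where
    j : Fin 5
    j = proj₁ explained

theorem5p4 : (A : BinMatrix 10 5) → IsCoveringArray 3 10 5 A → Equivalent A M₀
theorem5p4 A cov =
  flip-equivalent (A zero)
    (Normalised.equivalent (flipBy (A zero) A) (flip-covering (A zero) A cov) (flip-first-row A))
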